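{- For a positive integer $n$, let $g(n)$ denote the largest integer $t$ for which there exist integers $0<a_1<a_2<\cdots<a_t\le n$ such that $P(a_i)>P(a_{i+1})$ for all $1\le i\le t-1$, where $P(m)$ denotes the largest prime divisor of $m$. Then $g(n)=\Theta\left(\left(\frac{n}{\log n}\right)^{1/2}\right)$; that is, there exist constants $C_1,C_2>0$ such that $C_1\left(\frac{n}{\log n}\right)^{1/2}\le g(n)\le C_2\left(\frac{n}{\log n}\right)^{1/2}$ for all sufficiently large $n$.
   Context: For an integer $m\ge 2$, $P(m)=\max\{p : p \text{ prime and } p\mid m\}$ denotes the largest prime factor of $m$. $\log$ denotes the natural logarithm. -}

module Defs where

open import Data.Nat using (ℕ; zero; suc; _+_; _*_; _≤_; _<_)
open import Data.Nat.Divisibility using (_∣_; _∣?_)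
open import Data.Nat.Primality using (Prime; prime?)
open import Data.List using (List; length)
open import Data.List.Relation.Unary.All using (All)
open import Data.List.Relation.Unary.Linked using (Linked)
open import Data.Product using (Σ; _×_)
open import Relation.Binary.PropositionalEquality using (_≡_)
open import Relation.Nullary using (yes; no)

largestPrimeFactorUpTo : ℕ → ℕ → ℕ
largestPrimeFactorUpTo zero m = 1
largestPrimeFactorUpTo (suc k) m with prime? (suc k) | suc k ∣? m
... | yes _ | yes _ = suc k
... | _     | _     = largestPrimeFactorUpTo k m

-- P m = largest prime divisor of m (for m ≥ 2); convention P 1 = 1.
P : ℕ → ℕ
P m = largestPrimeFactorUpTo m m

Admissible : ℕ → List ℕ → Set
Admissible n xs =
  All (λ a → 0 < a × a ≤ n) xs ×
  Linked (λ a b → a < b × P b < P a) xs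

-- t is attained: some admissible sequence of length t exists.
-- g(n) is the largest t with Attainable n t.
Attainable : ℕ → ℕ → Set
Attainable n t = Σ (List ℕ) (λ xs → Admissible n xs × length xs ≡ t)

{-# OPTIONS --safe #-}
module Submission where

-- Write each term of an admissible sequence as a = P(a) · c(a). As the terms increase while their
-- largest prime factors decrease, the cofactors c strictly increase, so the middle term b = a_j
-- (j ≈ t/2) satisfies j · P(b) ≤ n, while the ≈ t/2 terms from b on have distinct largest prime
-- factors, all at most Y = P(b). Chebyshev's bound k · log Y = O(Y) for k distinct primes up to Y
-- gives t² · log Y = O(n), and log n = O(log Y) unless Y, and hence t, is tiny.
-- Conversely, for primes q₁ > ⋯ > q_t in (y, x] with t · x ≤ y², the least multiple a_i of q_i
-- exceeding a_(i-1) satisfies a_i ≤ i · x ≤ y² < q_i², so its cofactor is below q_i and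
-- P(a_i) = q_i. Chebyshev's bounds, the upper one via ∏_(p ≤ X) p ≤ 8^X and the lower one via
-- Nair's lcm(1, …, 2m + 1) ≥ 2^m, supply t ≈ (n / log n)^(1/2) such primes in a window (y, 2⁷ y].

open import Data.Bool.Base using (true; false)
import Data.Fin.Base as Fin
open import Data.Fin.Properties using (toℕ≤pred[n])
open import Data.List.Base using (List; []; _∷_; _++_; length; filter; map; take)
open import Data.List.Membership.Propositional using (_∈_)
open import Data.List.Membership.Propositional.Properties using (∈-map⁺)
open import Data.List.Properties using (length-++; length-map; length-take; map-++)
open import Data.List.Relation.Unary.All as All using (All; []; _∷_)
import Data.List.Relation.Unary.All.Properties as Allₚ
import Data.List.Relation.Unary.AllPairs.Properties as AllPairsₚ
open import Data.List.Relation.Unary.Any using (here; there)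
open import Data.List.Relation.Unary.Linked as Linked using (Linked; []; [-]; _∷_)
open import Data.List.Relation.Unary.Linked.Properties as Linkedₚ using (Linked⇒All)
open import Data.Nat
open import Data.Nat.Divisibility
open import Data.Nat.DivMod using (_divMod_; DivMod; result; m≡m%n+[m/n]*n; m%n<n; m/n*n≤m)
open import Data.Nat.Induction using (<-rec)
open import Data.Nat.ListAction using (product)
open import Data.Nat.ListAction.Properties using (∈⇒∣product; product≢0)
open import Data.Nat.Logarithm
open import Data.Nat.Primality
open import Data.Nat.Primality.Factorisation using (factorise)
open import Data.Nat.Properties
open import Algebra.Properties.CommutativeSemigroup *-commutativeSemigroup using (x∙yz≈y∙xz)
open import Data.Nat.Tactic.RingSolver using (solve-∀)
open import Data.Product using (Σ; ∃₂; ∃-syntax; _×_; _,_; proj₁; proj₂)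
open import Data.Sum using (_⊎_; inj₁; inj₂)
open import Function.Base using (_∘_)
open import Relation.Binary.Definitions using (Transitive)
open import Relation.Binary.PropositionalEquality
open import Relation.Nullary using (¬?; yes; no; does; contradiction)
open import Relation.Unary using (Decidable)

open import Defs

2^m≤2^n⇒m≤n : ∀ {m n} → 2 ^ m ≤ 2 ^ n → m ≤ n
2^m≤2^n⇒m≤n {m} {n} 2^m≤2^n with m ≤? n
... | yes m≤n = m≤n
... | no m≰n  = contradiction (^-monoʳ-< 2 (s≤s (s≤s z≤n)) (≰⇒> m≰n)) (≤⇒≯ 2^m≤2^n)

2^m<2^n⇒m<n : ∀ {m n} → 2 ^ m < 2 ^ n → m < n
2^m<2^n⇒m<n {m} {n} 2^m<2^n with m <? n
... | yes m<n = m<n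
... | no m≮n  = contradiction (^-monoʳ-≤ 2 (≮⇒≥ m≮n)) (<⇒≱ 2^m<2^n)

n+n≤2^n : ∀ n → n + n ≤ 2 ^ n
n+n≤2^n zero          = z≤n
n+n≤2^n (suc zero)    = s≤s (s≤s z≤n)
n+n≤2^n (suc (suc n)) = begin
  suc (suc n) + suc (suc n)     ≡⟨ cong suc (+-suc (suc n) (suc n)) ⟩
  2 + (suc n + suc n)           ≤⟨ +-mono-≤ (*-monoʳ-≤ 2 (m^n>0 2 n)) (n+n≤2^n (suc n)) ⟩
  2 * 2 ^ n + 2 ^ suc n         ≡⟨ cong (2 ^ suc n +_) (+-identityʳ (2 ^ suc n)) ⟨
  2 * 2 ^ suc n                 ∎
  where open ≤-Reasoning

⌈n/2⌉≤1+⌊n/2⌋ : ∀ n → ⌈ n /2⌉ ≤ suc ⌊ n /2⌋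
⌈n/2⌉≤1+⌊n/2⌋ zero          = z≤n
⌈n/2⌉≤1+⌊n/2⌋ (suc zero)    = s≤s z≤n
⌈n/2⌉≤1+⌊n/2⌋ (suc (suc n)) = s≤s (⌈n/2⌉≤1+⌊n/2⌋ n)

⌊log₂⌋-bounds : ∀ n → 0 < n → 2 ^ ⌊log₂ n ⌋ ≤ n × n < 2 ^ suc ⌊log₂ n ⌋
⌊log₂⌋-bounds = <-rec _ bounds
  where
  bounds : ∀ n → (∀ {m} → m < n → 0 < m → 2 ^ ⌊log₂ m ⌋ ≤ m × m < 2 ^ suc ⌊log₂ m ⌋) →
           0 < n → 2 ^ ⌊log₂ n ⌋ ≤ n × n < 2 ^ suc ⌊log₂ n ⌋
  bounds 1 _ _ = s≤s z≤n , s≤s (s≤s z≤n)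
  bounds n@(suc (suc k)) rec _ = lower , upper
    where
    h = ⌊ n /2⌋
    ⌊log₂n⌋≡1+⌊log₂h⌋ : ⌊log₂ n ⌋ ≡ suc ⌊log₂ h ⌋
    ⌊log₂n⌋≡1+⌊log₂h⌋ = begin
      ⌊log₂ n ⌋           ≡⟨ m+[n∸m]≡n (⌊log₂⌋-mono-≤ {2} {n} (s≤s (s≤s z≤n))) ⟨
      1 + (⌊log₂ n ⌋ ∸ 1) ≡⟨ cong suc (⌊log₂⌊n/2⌋⌋≡⌊log₂n⌋∸1 n) ⟨
      suc ⌊log₂ h ⌋       ∎
      where open ≡-Reasoning
    ih = rec (⌊n/2⌋<n (suc k)) (s≤s z≤n)
    n≡h+⌈n/2⌉ = sym (⌊n/2⌋+⌈n/2⌉≡n n)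
    lower : 2 ^ ⌊log₂ n ⌋ ≤ n
    lower = begin
      2 ^ ⌊log₂ n ⌋          ≡⟨ cong (2 ^_) ⌊log₂n⌋≡1+⌊log₂h⌋ ⟩
      2 * 2 ^ ⌊log₂ h ⌋      ≤⟨ *-monoʳ-≤ 2 (proj₁ ih) ⟩
      2 * h                  ≡⟨ cong (h +_) (+-identityʳ h) ⟩
      h + h                  ≤⟨ +-monoʳ-≤ h (⌊n/2⌋≤⌈n/2⌉ n) ⟩
      h + ⌈ n /2⌉            ≡⟨ n≡h+⌈n/2⌉ ⟨
      n                      ∎
      where open ≤-Reasoning
    upper : n < 2 ^ suc ⌊log₂ n ⌋
    upper = begin-strict
      n                              ≡⟨ n≡h+⌈n/2⌉ ⟩
      h + ⌈ n /2⌉                    ≤⟨ +-monoʳ-≤ h (⌈n/2⌉≤1+⌊n/2⌋ n) ⟩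
      h + suc h                      <⟨ ≤-reflexive (cong (suc h +_) (sym (+-identityʳ (suc h)))) ⟩
      2 * suc h                      ≤⟨ *-monoʳ-≤ 2 (proj₂ ih) ⟩
      2 * 2 ^ suc ⌊log₂ h ⌋          ≡⟨ cong (λ e → 2 ^ suc e) ⌊log₂n⌋≡1+⌊log₂h⌋ ⟨
      2 ^ suc ⌊log₂ n ⌋              ∎
      where open ≤-Reasoning

n<2^[1+⌊log₂n⌋] : ∀ n → n < 2 ^ suc ⌊log₂ n ⌋
n<2^[1+⌊log₂n⌋] zero        = s≤s z≤n
n<2^[1+⌊log₂n⌋] n@(suc _)   = proj₂ (⌊log₂⌋-bounds n (s≤s z≤n))

2^k≤n⇒k≤⌊log₂n⌋ : ∀ {k n} → 2 ^ k ≤ n → k ≤ ⌊log₂ n ⌋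
2^k≤n⇒k≤⌊log₂n⌋ {k} {n} 2^k≤n = ≤-pred (2^m<2^n⇒m<n (≤-<-trans 2^k≤n (n<2^[1+⌊log₂n⌋] n)))

n<2^k⇒⌊log₂n⌋<k : ∀ {n k} → 0 < n → n < 2 ^ k → ⌊log₂ n ⌋ < k
n<2^k⇒⌊log₂n⌋<k {n} 0<n n<2^k = 2^m<2^n⇒m<n (≤-<-trans (proj₁ (⌊log₂⌋-bounds n 0<n)) n<2^k)

⌊log₂n⌋+15≤n : ∀ {n} → 32 ≤ n → ⌊log₂ n ⌋ + 15 ≤ n
⌊log₂n⌋+15≤n {n} 32≤n with ⌊log₂ n ⌋ ≤? 15
... | yes k≤15 = ≤-trans (+-monoˡ-≤ 15 k≤15) (≤-trans (m≤m+n 30 2) 32≤n)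
... | no k≰15  = begin
  k + 15        ≤⟨ +-monoʳ-≤ k (<⇒≤ (≰⇒> k≰15)) ⟩
  k + k         ≤⟨ n+n≤2^n k ⟩
  2 ^ k         ≤⟨ proj₁ (⌊log₂⌋-bounds n (≤-trans (s≤s z≤n) 32≤n)) ⟩
  n             ∎
  where
  open ≤-Reasoning
  k = ⌊log₂ n ⌋

2^a*2^a*⌊log₂n⌋≤n : ∀ a n → 4 * a ≤ ⌊log₂ n ⌋ → 2 ^ a * 2 ^ a * ⌊log₂ n ⌋ ≤ n
2^a*2^a*⌊log₂n⌋≤n a zero      _    = ≤-reflexive (*-zeroʳ (2 ^ a * 2 ^ a))
2^a*2^a*⌊log₂n⌋≤n a n@(suc _) 4a≤ℓ = begin
  2 ^ a * 2 ^ a * ℓ       ≤⟨ *-monoʳ-≤ (2 ^ a * 2 ^ a) (≤-trans ℓ≤d+d (n+n≤2^n d)) ⟩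
  2 ^ a * 2 ^ a * 2 ^ d   ≡⟨ cong (_* 2 ^ d) (^-distribˡ-+-* 2 a a) ⟨
  2 ^ (a + a) * 2 ^ d     ≡⟨ ^-distribˡ-+-* 2 (a + a) d ⟨
  2 ^ (a + a + d)         ≡⟨ cong (2 ^_) a+a+d≡ℓ ⟩
  2 ^ ℓ                   ≤⟨ proj₁ (⌊log₂⌋-bounds n (s≤s z≤n)) ⟩
  n                       ∎
  where
  open ≤-Reasoning
  ℓ = ⌊log₂ n ⌋
  d = ℓ ∸ (a + a)
  a+a+[a+a]≤ℓ : a + a + (a + a) ≤ ℓ
  a+a+[a+a]≤ℓ = subst (_≤ ℓ) (four a) 4a≤ℓ
    where
    four : ∀ a → 4 * a ≡ a + a + (a + a)
    four = solve-∀
  a+a+d≡ℓ : a + a + d ≡ ℓ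
  a+a+d≡ℓ = m+[n∸m]≡n (m+n≤o⇒m≤o (a + a) a+a+[a+a]≤ℓ)
  ℓ≤d+d : ℓ ≤ d + d
  ℓ≤d+d = ≤-trans (≤-reflexive (sym a+a+d≡ℓ)) (+-monoˡ-≤ d (m+n≤o⇒m≤o∸n (a + a) a+a+[a+a]≤ℓ))

prime⇒2≤ : ∀ {p} → Prime p → 2 ≤ p
prime⇒2≤ {p} pp = nonTrivial⇒n>1 p {{prime⇒nonTrivial pp}}

prime-divisor : ∀ n → 1 < n → ∃[ p ] Prime p × p ∣ n
prime-divisor 1               (s≤s ())
prime-divisor n@(suc (suc _)) _ with factorise n
... | record { factors = p ∷ ps ; isFactorisation = n≡p*∏ps ; factorsPrime = pp ∷ _ } =
  p , pp , divides (product ps) (trans n≡p*∏ps (*-comm p (product ps)))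

p∤m∧p∤n⇒p∤m*n : ∀ {p m n} → Prime p → p ∤ m → p ∤ n → p ∤ m * n
p∤m∧p∤n⇒p∤m*n {m = m} {n} pp p∤m p∤n p∣mn with euclidsLemma m n pp p∣mn
... | inj₁ p∣m = p∤m p∣m
... | inj₂ p∣n = p∤n p∣n

p∤product : ∀ {p es} → Prime p → All (p ∤_) es → p ∤ product es
p∤product pp []             p∣1 = contradiction (∣1⇒≡1 p∣1) (>⇒≢ (prime⇒2≤ pp))
p∤product pp (p∤e ∷ p∤es)       = p∤m∧p∤n⇒p∤m*n pp p∤e (p∤product pp p∤es)

p^k∣m*n⇒p^k∣n : ∀ {p m} k {n} → Prime p → p ∤ m → p ^ k ∣ m * n → p ^ k ∣ n
p^k∣m*n⇒p^k∣n         zero    {n} _  _   _     = 1∣ n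
p^k∣m*n⇒p^k∣n {p} {m} (suc k) {n} pp p∤m p^k∣mn with euclidsLemma m n pp (∣-trans (m∣m*n (p ^ k)) p^k∣mn)
... | inj₁ p∣m               = contradiction p∣m p∤m
... | inj₂ (divides n′ refl) = subst (p * p ^ k ∣_) (*-comm p n′) (*-monoʳ-∣ p p^k∣n′)
  where
  instance _ = prime⇒nonZero pp
  p^k∣n′ : p ^ k ∣ n′
  p^k∣n′ = p^k∣m*n⇒p^k∣n k pp p∤m (*-cancelˡ-∣ p (subst (p * p ^ k ∣_) (trans (cong (m *_) (*-comm n′ p)) (x∙yz≈y∙xz m p n′)) p^k∣mn))

p∤m⇒p^k*m∣n : ∀ {p m n} k → Prime p → p ∤ m → p ^ k ∣ n → m ∣ n → p ^ k * m ∣ n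
p∤m⇒p^k*m∣n {p} {m} k pp p∤m p^k∣n (divides n′ refl) =
  *-monoˡ-∣ m (p^k∣m*n⇒p^k∣n k pp p∤m (subst (p ^ k ∣_) (*-comm n′ m) p^k∣n))

m≤n⇒p^m∣p^n : ∀ p {m n} → m ≤ n → p ^ m ∣ p ^ n
m≤n⇒p^m∣p^n p {m} {n} m≤n = divides (p ^ (n ∸ m)) (trans (cong (p ^_) (sym (m∸n+n≡m m≤n))) (^-distribˡ-+-* p (n ∸ m) m))

d∣n! : ∀ {d n} → 0 < d → d ≤ n → d ∣ n !
d∣n! {suc d} _ d≤n = ∣-trans (m∣m*n (d !)) (m≤n⇒m!∣n! d≤n)

prime∤k! : ∀ {p} k → Prime p → k < p → p ∤ k !
prime∤k! zero    pp _   = p∤product pp []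
prime∤k! (suc k) pp k<p = p∤m∧p∤n⇒p∤m*n pp (>⇒∤ k<p) (prime∤k! k pp (<-trans (n<1+n k) k<p))

prime-power-decomposition : ∀ {p} → Prime p → ∀ i → 0 < i → ∃₂ λ k r → i ≡ p ^ k * r × p ∤ r
prime-power-decomposition {p} pp = <-rec _ decompose
  where
  instance _ = prime⇒nonZero pp
  decompose : ∀ i → (∀ {j} → j < i → 0 < j → ∃₂ λ k r → j ≡ p ^ k * r × p ∤ r) → 0 < i → ∃₂ λ k r → i ≡ p ^ k * r × p ∤ r
  decompose i rec 0<i with p ∣? i
  ... | no p∤i                = 0 , i , sym (+-identityʳ i) , p∤i
  ... | yes (divides j i≡j*p) with rec j<i 0<j
    where
    0<j : 0 < j
    0<j = n≢0⇒n>0 λ { refl → <⇒≢ 0<i (sym i≡j*p) }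
    j<i : j < i
    j<i = subst (j <_) (sym i≡j*p) (m<m*n j p {{>-nonZero 0<j}} (prime⇒2≤ pp))
  ... | k , r , j≡p^k*r , p∤r = suc k , r , trans i≡j*p (trans (cong (_* p) j≡p^k*r) (rotate (p ^ k) r p)) , p∤r
    where
    rotate : ∀ a b c → a * b * c ≡ c * a * b
    rotate = solve-∀

-- P 1 = 1, so a 1 may occur as the last largest prime factor along an admissible sequence.
PrimeOrOne : ℕ → Set
PrimeOrOne p = p ≡ 1 ⊎ Prime p

primeOrOne⇒0< : ∀ {p} → PrimeOrOne p → 0 < p
primeOrOne⇒0< (inj₁ refl) = s≤s z≤n
primeOrOne⇒0< (inj₂ pp)   = ≤-trans (s≤s z≤n) (prime⇒2≤ pp)

largestPrimeFactorUpTo-primeOrOne∣ : ∀ k m → PrimeOrOne (largestPrimeFactorUpTo k m) × largestPrimeFactorUpTo k m ∣ m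
largestPrimeFactorUpTo-primeOrOne∣ zero    m = inj₁ refl , 1∣ m
largestPrimeFactorUpTo-primeOrOne∣ (suc k) m with prime? (suc k) | suc k ∣? m
... | yes pk | yes k∣m = inj₂ pk , k∣m
... | yes _  | no _    = largestPrimeFactorUpTo-primeOrOne∣ k m
... | no _   | _       = largestPrimeFactorUpTo-primeOrOne∣ k m

largestPrimeFactorUpTo-maximal : ∀ k {m p} → Prime p → p ∣ m → p ≤ k → p ≤ largestPrimeFactorUpTo k m
largestPrimeFactorUpTo-maximal zero    pp _   p≤0   = contradiction (≤-trans (prime⇒2≤ pp) p≤0) λ ()
largestPrimeFactorUpTo-maximal (suc k) {m} {p} pp p∣m p≤1+k with prime? (suc k) | suc k ∣? m
... | yes _ | yes _ = p≤1+k
... | yes _ | no k∤m  = largestPrimeFactorUpTo-maximal k pp p∣m (≤-pred (≤∧≢⇒< p≤1+k λ { refl → k∤m p∣m }))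
... | no ¬pk | _      = largestPrimeFactorUpTo-maximal k pp p∣m (≤-pred (≤∧≢⇒< p≤1+k λ { refl → ¬pk pp }))

P-primeOrOne : ∀ m → PrimeOrOne (P m)
P-primeOrOne m = proj₁ (largestPrimeFactorUpTo-primeOrOne∣ m m)

P∣n : ∀ n → P n ∣ n
P∣n n = proj₂ (largestPrimeFactorUpTo-primeOrOne∣ n n)

P[q*m]≡q : ∀ {q m} → Prime q → 0 < m → m ≤ q → P (q * m) ≡ q
P[q*m]≡q {q} {m} pq 0<m m≤q = ≤-antisym P[qm]≤q q≤P[qm]
  where
  instance
    _ = prime⇒nonZero pq
    _ = >-nonZero 0<m
  q≤P[qm] : q ≤ P (q * m)
  q≤P[qm] = largestPrimeFactorUpTo-maximal (q * m) pq (m∣m*n m) (m≤m*n q m)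
  P[qm]≤q : P (q * m) ≤ q
  P[qm]≤q with P-primeOrOne (q * m)
  ... | inj₁ P≡1 = ≤-trans (≤-reflexive P≡1) (≤-trans (s≤s z≤n) (prime⇒2≤ pq))
  ... | inj₂ pP with euclidsLemma q m pP (P∣n (q * m))
  ...   | inj₁ P∣q = ∣⇒≤ P∣q
  ...   | inj₂ P∣m = ≤-trans (∣⇒≤ P∣m) m≤q

>-trans : ∀ {a b c} → a > b → b > c → a > c
>-trans a>b b>c = <-trans b>c a>b

Linked-∷⇒All : ∀ {R : ℕ → ℕ → Set} → Transitive R → ∀ {x xs} → Linked R (x ∷ xs) → All (R x) xs
Linked-∷⇒All R-trans [-]       = []
Linked-∷⇒All R-trans (Rxy ∷ l) = Linked⇒All R-trans Rxy l

Linked-++⁻ʳ : ∀ {R : ℕ → ℕ → Set} xs {ys} → Linked R (xs ++ ys) → Linked R ys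
Linked-++⁻ʳ []       l = l
Linked-++⁻ʳ (_ ∷ xs) l = Linked-++⁻ʳ xs (Linked.tail l)

increasing-gap : ∀ {x y} ys {zs} → Linked _<_ (x ∷ ys ++ y ∷ zs) → x + length ys < y
increasing-gap {x} []       (x<y ∷ _) = subst (_< _) (sym (+-identityʳ x)) x<y
increasing-gap {x} (u ∷ ys) (x<u ∷ l) = ≤-<-trans (≤-reflexive (+-suc x (length ys))) (≤-<-trans (+-monoˡ-≤ (length ys) x<u) (increasing-gap ys l))

split-at : ∀ {A : Set} j (xs : List A) → j < length xs → ∃[ pre ] ∃[ b ] ∃[ post ] xs ≡ pre ++ b ∷ post × length pre ≡ j
split-at zero    (x ∷ xs) _         = [] , x , xs , refl , refl
split-at (suc j) (x ∷ xs) (s≤s j<∣xs∣) with split-at j xs j<∣xs∣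
... | pre , b , post , refl , refl = x ∷ pre , b , post , refl , refl

length≤head : ∀ {h ps} → Linked _>_ (h ∷ ps) → All (0 <_) (h ∷ ps) → length (h ∷ ps) ≤ h
length≤head [-]       (0<h ∷ _)    = 0<h
length≤head (h>x ∷ l) (_ ∷ 0<xs)   = ≤-trans (s≤s (length≤head l 0<xs)) h>x

length≤ : ∀ {Y ps} → Linked _>_ ps → All (0 <_) ps → All (_≤ Y) ps → length ps ≤ Y
length≤ {ps = []}    _ _ _         = z≤n
length≤ {ps = _ ∷ _} l 0<ps (h≤Y ∷ _) = ≤-trans (length≤head l 0<ps) h≤Y

product-filter : ∀ {P : ℕ → Set} (P? : Decidable P) xs →
                 product xs ≡ product (filter P? xs) * product (filter (¬? ∘ P?) xs)
product-filter P? []       = refl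
product-filter P? (x ∷ xs) with does (P? x)
... | true  = trans (cong (x *_) (product-filter P? xs)) (sym (*-assoc x (product (filter P? xs)) _))
... | false = trans (cong (x *_) (product-filter P? xs)) (x∙yz≈y∙xz x (product (filter P? xs)) _)

product-primes∣ : ∀ {ps n} → Linked _>_ ps → All Prime ps → All (_∣ n) ps → product ps ∣ n
product-primes∣ {[]}     {n} _ _ _ = 1∣ n
product-primes∣ {p ∷ ps} {n} l (pp ∷ pps) (p∣n ∷ ps∣n) =
  subst (_∣ n) (cong (_* product ps) (*-identityʳ p))
    (p∤m⇒p^k*m∣n 1 pp p∤∏ps (subst (_∣ n) (sym (*-identityʳ p)) p∣n) (product-primes∣ (Linked.tail l) pps ps∣n))
  where
  p∤∏ps : p ∤ product ps
  p∤∏ps = p∤product pp (All.zipWith (λ (qq , q<p) → >⇒∤ {{prime⇒nonZero qq}} q<p) (pps , Linked-∷⇒All >-trans l))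

product≤! : ∀ X {ps} → Linked _>_ ps → All (_≤ X) ps → product ps ≤ X !
product≤! X {[]}         _ _           = 1≤n! X
product≤! X {zero ∷ _}   _ _           = z≤n
product≤! X {suc h ∷ ps} l (1+h≤X ∷ _) = begin
  suc h * product ps ≤⟨ *-monoʳ-≤ (suc h) (product≤! h (Linked.tail l) (All.map ≤-pred (Linked-∷⇒All >-trans l))) ⟩
  suc h !            ≤⟨ !-mono 1+h≤X ⟩
  X !                ∎
  where
  open ≤-Reasoning
  !-mono : ∀ {m n} → m ≤ n → m ! ≤ n !
  !-mono {n = n} m≤n = ∣⇒≤ {{n !≢0}} (m≤n⇒m!∣n! m≤n)

[1+s]^[length∸s]≤product : ∀ s {ps} → Linked _>_ ps → All (0 <_) ps → suc s ^ (length ps ∸ s) ≤ product ps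
[1+s]^[length∸s]≤product s {[]}     _ _ = subst (λ e → suc s ^ e ≤ 1) (sym (0∸n≡0 s)) ≤-refl
[1+s]^[length∸s]≤product s {h ∷ ps} l 0<hps@(_ ∷ 0<ps) with s ≤? length ps
... | yes s≤∣ps∣ = begin
  suc s ^ (suc (length ps) ∸ s)   ≡⟨ cong (suc s ^_) (+-∸-assoc 1 s≤∣ps∣) ⟩
  suc s * suc s ^ (length ps ∸ s) ≤⟨ *-mono-≤ (≤-trans (s≤s s≤∣ps∣) (length≤head l 0<hps)) ([1+s]^[length∸s]≤product s (Linked.tail l) 0<ps) ⟩
  h * product ps                  ∎
  where open ≤-Reasoning
... | no s≰∣ps∣ = begin
  suc s ^ (suc (length ps) ∸ s)   ≡⟨ cong (suc s ^_) (m≤n⇒m∸n≡0 (≰⇒> s≰∣ps∣)) ⟩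
  1                               ≤⟨ >-nonZero⁻¹ _ {{product≢0 (All.map >-nonZero 0<hps)}} ⟩
  h * product ps                  ∎
  where open ≤-Reasoning

-- Binomial coefficients

-- binomial a b is the binomial coefficient (a + b choose a).
binomial : ℕ → ℕ → ℕ
binomial zero    _       = 1
binomial (suc a) zero    = 1
binomial (suc a) (suc b) = binomial a (suc b) + binomial (suc a) b

binomial[a,0]≡1 : ∀ a → binomial a 0 ≡ 1
binomial[a,0]≡1 zero    = refl
binomial[a,0]≡1 (suc a) = refl

binomial>0 : ∀ a b → 0 < binomial a b
binomial>0 zero    _       = s≤s z≤n
binomial>0 (suc a) zero    = s≤s z≤n
binomial>0 (suc a) (suc b) = ≤-trans (binomial>0 a (suc b)) (m≤m+n _ _)

binomial-monoˡ : ∀ a b → binomial a b ≤ binomial (suc a) b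
binomial-monoˡ zero    zero    = ≤-refl
binomial-monoˡ (suc a) zero    = ≤-refl
binomial-monoˡ a       (suc b) = m≤m+n _ _

binomial-monoʳ : ∀ a b → binomial a b ≤ binomial a (suc b)
binomial-monoʳ zero    b = ≤-refl
binomial-monoʳ (suc a) b = m≤n+m _ _

binomial≤2^ : ∀ a b → binomial a b ≤ 2 ^ (a + b)
binomial≤2^ zero    b       = m^n>0 2 b
binomial≤2^ (suc a) zero    = m^n>0 2 (suc a + 0)
binomial≤2^ (suc a) (suc b) = begin
  binomial a (suc b) + binomial (suc a) b ≤⟨ +-mono-≤ (binomial≤2^ a (suc b)) (binomial≤2^ (suc a) b) ⟩
  2 ^ (a + suc b) + 2 ^ (suc a + b)       ≡⟨ cong (λ e → 2 ^ e + 2 ^ suc (a + b)) (+-suc a b) ⟩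
  2 ^ suc (a + b) + 2 ^ suc (a + b)       ≡⟨ cong (2 ^ suc (a + b) +_) (+-identityʳ (2 ^ suc (a + b))) ⟨
  2 ^ suc (suc a + b)                     ≡⟨ cong (λ e → 2 ^ suc e) (+-suc a b) ⟨
  2 ^ (suc a + suc b)                     ∎
  where open ≤-Reasoning

2^m≤binomial[m,m] : ∀ m → 2 ^ m ≤ binomial m m
2^m≤binomial[m,m] zero    = ≤-refl
2^m≤binomial[m,m] (suc m) = begin
  2 ^ m + (2 ^ m + 0)                         ≡⟨ cong (2 ^ m +_) (+-identityʳ (2 ^ m)) ⟩
  2 ^ m + 2 ^ m                               ≤⟨ +-mono-≤ (≤-trans (2^m≤binomial[m,m] m) (binomial-monoʳ m m))
                                                           (≤-trans (2^m≤binomial[m,m] m) (binomial-monoˡ m m)) ⟩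
  binomial m (suc m) + binomial (suc m) m     ∎
  where open ≤-Reasoning

binomial*a!*b!≡[a+b]! : ∀ a b → binomial a b * (a ! * b !) ≡ (a + b) !
binomial*a!*b!≡[a+b]! zero    b       = trans (+-identityʳ _) (+-identityʳ _)
binomial*a!*b!≡[a+b]! (suc a) zero    = trans (+-identityʳ _) (trans (*-identityʳ _) (cong _! (sym (+-identityʳ (suc a)))))
binomial*a!*b!≡[a+b]! (suc a) (suc b) = begin
  (binomial a (suc b) + binomial (suc a) b) * ((suc a * a !) * (suc b * b !))
    ≡⟨ distribute (binomial a (suc b)) (binomial (suc a) b) a b (a !) (b !) ⟩
  suc a * (binomial a (suc b) * (a ! * suc b !)) + suc b * (binomial (suc a) b * (suc a ! * b !))
    ≡⟨ cong₂ (λ u v → suc a * u + suc b * v) (binomial*a!*b!≡[a+b]! a (suc b)) (binomial*a!*b!≡[a+b]! (suc a) b) ⟩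
  suc a * (a + suc b) ! + suc b * (suc a + b) !
    ≡⟨ cong (λ e → suc a * e ! + suc b * (suc a + b) !) (+-suc a b) ⟩
  suc a * (suc a + b) ! + suc b * (suc a + b) !
    ≡⟨ *-distribʳ-+ ((suc a + b) !) (suc a) (suc b) ⟨
  (suc a + suc b) * (suc a + b) !
    ≡⟨ cong (λ e → (suc a + suc b) * e !) (+-suc a b) ⟨
  (suc a + suc b) !
    ∎
  where
  open ≡-Reasoning
  distribute : ∀ x y a b a! b! → (x + y) * ((suc a * a!) * (suc b * b!)) ≡
               suc a * (x * (a! * (suc b * b!))) + suc b * (y * ((suc a * a!) * b!))
  distribute = solve-∀

[1+r]*binomial[m,1+r]≡[1+m+r]*binomial[m,r] : ∀ m r → suc r * binomial m (suc r) ≡ suc (m + r) * binomial m r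
[1+r]*binomial[m,1+r]≡[1+m+r]*binomial[m,r] m r = *-cancelʳ-≡ _ _ (m ! * suc r !) {{m !* suc r !≢0}} (begin
  suc r * binomial m (suc r) * (m ! * suc r !)                 ≡⟨ *-assoc (suc r) (binomial m (suc r)) (m ! * suc r !) ⟩
  suc r * (binomial m (suc r) * (m ! * suc r !))               ≡⟨ cong (suc r *_) (binomial*a!*b!≡[a+b]! m (suc r)) ⟩
  suc r * (m + suc r) !                                         ≡⟨ cong (λ e → suc r * e !) (+-suc m r) ⟩
  suc r * (suc (m + r) * (m + r) !)                             ≡⟨ cong (λ e → suc r * (suc (m + r) * e)) (binomial*a!*b!≡[a+b]! m r) ⟨
  suc r * (suc (m + r) * (binomial m r * (m ! * r !)))          ≡⟨ rearrange (suc r) (suc (m + r)) (binomial m r) (m !) (r !) ⟩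
  suc (m + r) * binomial m r * (m ! * suc r !)                  ∎)
  where
  open ≡-Reasoning
  rearrange : ∀ r′ s x m! r! → r′ * (s * (x * (m! * r!))) ≡ s * x * (m! * (r′ * r!))
  rearrange = solve-∀

[1+r]*binomial[m,1+r]≡[1+m]*binomial[1+m,r] : ∀ m r → suc r * binomial m (suc r) ≡ suc m * binomial (suc m) r
[1+r]*binomial[m,1+r]≡[1+m]*binomial[1+m,r] m r = *-cancelʳ-≡ _ _ (suc m ! * suc r !) {{suc m !* suc r !≢0}} (begin
  suc r * binomial m (suc r) * (suc m ! * suc r !)                   ≡⟨ rearrange (suc r) (suc m) (binomial m (suc r)) (m !) (suc r !) ⟩
  suc r * suc m * (binomial m (suc r) * (m ! * suc r !))             ≡⟨ cong (suc r * suc m *_) (binomial*a!*b!≡[a+b]! m (suc r)) ⟩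
  suc r * suc m * (m + suc r) !                                       ≡⟨ cong₂ (λ x e → x * e !) (*-comm (suc r) (suc m)) (+-suc m r) ⟩
  suc m * suc r * (suc m + r) !                                       ≡⟨ cong (suc m * suc r *_) (binomial*a!*b!≡[a+b]! (suc m) r) ⟨
  suc m * suc r * (binomial (suc m) r * (suc m ! * r !))             ≡⟨ rearrange′ (suc m) (suc r) (binomial (suc m) r) (m !) (r !) ⟩
  suc m * binomial (suc m) r * (suc m ! * suc r !)                   ∎)
  where
  open ≡-Reasoning
  rearrange : ∀ r′ m′ x m! g → r′ * x * ((m′ * m!) * g) ≡ r′ * m′ * (x * (m! * g))
  rearrange = solve-∀
  rearrange′ : ∀ m′ r′ y m! r! → m′ * r′ * (y * ((m′ * m!) * r!)) ≡ m′ * y * ((m′ * m!) * (r′ * r!))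
  rearrange′ = solve-∀

prime∣binomial : ∀ {p a b} → Prime p → a < p → b < p → p ≤ a + b → p ∣ binomial a b
prime∣binomial {p} {a} {b} pp a<p b<p p≤a+b
  with euclidsLemma (binomial a b) (a ! * b !) pp
         (subst (p ∣_) (sym (binomial*a!*b!≡[a+b]! a b)) (d∣n! (≤-trans (s≤s z≤n) (prime⇒2≤ pp)) p≤a+b))
... | inj₁ p∣binomial = p∣binomial
... | inj₂ p∣a!b!     = contradiction p∣a!b! (p∤m∧p∤n⇒p∤m*n pp (prime∤k! a pp a<p) (prime∤k! b pp b<p))

consecutive∣⇒m*binomial∣ : ∀ r m {D} → (∀ k → k ≤ r → m + k ∣ D) → m * binomial m r ∣ D
consecutive∣⇒m*binomial∣ zero m {D} m+k∣D =
  subst (_∣ D) (trans (+-identityʳ m) (sym (trans (cong (m *_) (binomial[a,0]≡1 m)) (*-identityʳ m)))) (m+k∣D 0 z≤n)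
consecutive∣⇒m*binomial∣ (suc r) m {D} m+k∣D
  with consecutive∣⇒m*binomial∣ r m (λ k k≤r → m+k∣D k (m≤n⇒m≤1+n k≤r))
     | consecutive∣⇒m*binomial∣ r (suc m) (λ k k≤r → subst (_∣ D) (+-suc m k) (m+k∣D (suc k) (s≤s k≤r)))
... | divides u D≡uX | divides v D≡vY = divides (u ∸ v) (sym (*-cancelʳ-≡ _ _ (suc r) (begin
  (u ∸ v) * Z * suc r                       ≡⟨ *-assoc (u ∸ v) Z (suc r) ⟩
  (u ∸ v) * (Z * suc r)                     ≡⟨ cong ((u ∸ v) *_) (*-comm Z (suc r)) ⟩
  (u ∸ v) * (suc r * Z)                     ≡⟨ *-distribʳ-∸ (suc r * Z) u v ⟩
  u * (suc r * Z) ∸ v * (suc r * Z)         ≡⟨ cong₂ (λ x y → u * x ∸ v * y) [1+r]Z≡[m+1+r]X [1+r]Z≡mY ⟩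
  u * ((m + suc r) * X) ∸ v * (m * Y)       ≡⟨ cong₂ _∸_ (x∙yz≈y∙xz u (m + suc r) X) (x∙yz≈y∙xz v m Y) ⟩
  (m + suc r) * (u * X) ∸ m * (v * Y)       ≡⟨ cong₂ (λ x y → (m + suc r) * x ∸ m * y) D≡uX D≡vY ⟨
  (m + suc r) * D ∸ m * D                   ≡⟨ cong (_∸ m * D) (*-distribʳ-+ D m (suc r)) ⟩
  m * D + suc r * D ∸ m * D                 ≡⟨ m+n∸m≡n (m * D) (suc r * D) ⟩
  suc r * D                                 ≡⟨ *-comm (suc r) D ⟩
  D * suc r                                 ∎)))
  where
  open ≡-Reasoning
  -- Nair's argument: (1 + r) · Z equals both (m + 1 + r) · X and m · Y, and X and Y divide D.
  X = m * binomial m r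
  Y = suc m * binomial (suc m) r
  Z = m * binomial m (suc r)
  [1+r]Z≡[m+1+r]X : suc r * Z ≡ (m + suc r) * X
  [1+r]Z≡[m+1+r]X = begin
    suc r * (m * binomial m (suc r))   ≡⟨ x∙yz≈y∙xz (suc r) m (binomial m (suc r)) ⟩
    m * (suc r * binomial m (suc r))   ≡⟨ cong (m *_) ([1+r]*binomial[m,1+r]≡[1+m+r]*binomial[m,r] m r) ⟩
    m * (suc (m + r) * binomial m r)   ≡⟨ x∙yz≈y∙xz m (suc (m + r)) (binomial m r) ⟩
    suc (m + r) * X                    ≡⟨ cong (_* X) (+-suc m r) ⟨
    (m + suc r) * X                    ∎
  [1+r]Z≡mY : suc r * Z ≡ m * Y
  [1+r]Z≡mY = trans (x∙yz≈y∙xz (suc r) m (binomial m (suc r)))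
                    (cong (m *_) ([1+r]*binomial[m,1+r]≡[1+m]*binomial[1+m,r] m r))

-- Chebyshev's upper bound

product[>1+m]≤2^[m+1+m] : ∀ m {ps} → Linked _>_ ps → All PrimeOrOne ps → All (_≤ m + suc m) ps →
                                     product (filter (suc m <?_) ps) ≤ 2 ^ (m + suc m)
product[>1+m]≤2^[m+1+m] m {ps} l po ≤2m+1 = begin
  product large                ≤⟨ ∣⇒≤ {{>-nonZero (binomial>0 m (suc m))}} (product-primes∣ large-descending large-prime large∣binomial) ⟩
  binomial m (suc m)           ≤⟨ binomial≤2^ m (suc m) ⟩
  2 ^ (m + suc m)              ∎
  where
  open ≤-Reasoning
  large = filter (suc m <?_) ps
  large-descending : Linked _>_ large
  large-descending = Linkedₚ.filter⁺ (suc m <?_) >-trans l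
  large-prime : All Prime large
  large-prime = All.zipWith primeOrOne⇒prime (Allₚ.all-filter (suc m <?_) ps , Allₚ.filter⁺ (suc m <?_) po)
    where
    primeOrOne⇒prime : ∀ {p} → suc m < p × PrimeOrOne p → Prime p
    primeOrOne⇒prime (_ , inj₂ pp) = pp
    primeOrOne⇒prime (s≤s () , inj₁ refl)
  large∣binomial : All (_∣ binomial m (suc m)) large
  large∣binomial = All.zipWith p∣binomial (large-prime , All.zip (Allₚ.all-filter (suc m <?_) ps , Allₚ.filter⁺ (suc m <?_) ≤2m+1))
    where
    p∣binomial : ∀ {p} → Prime p × suc m < p × p ≤ m + suc m → p ∣ binomial m (suc m)
    p∣binomial (pp , 1+m<p , p≤2m+1) = prime∣binomial pp (<-trans (n<1+n m) 1+m<p) 1+m<p p≤2m+1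

2^[m+1+m]*8^[1+m]≤8^[m+1+m] : ∀ m → 0 < m → 2 ^ (m + suc m) * 8 ^ suc m ≤ 8 ^ (m + suc m)
2^[m+1+m]*8^[1+m]≤8^[m+1+m] m 0<m = begin
  2 ^ (m + suc m) * 8 ^ suc m         ≡⟨ cong (2 ^ (m + suc m) *_) (^-*-assoc 2 3 (suc m)) ⟩
  2 ^ (m + suc m) * 2 ^ (3 * suc m)   ≡⟨ ^-distribˡ-+-* 2 (m + suc m) (3 * suc m) ⟨
  2 ^ (m + suc m + 3 * suc m)         ≤⟨ ^-monoʳ-≤ 2 exponent-≤ ⟩
  2 ^ (3 * (m + suc m))               ≡⟨ ^-*-assoc 2 3 (m + suc m) ⟨
  8 ^ (m + suc m)                     ∎
  where
  open ≤-Reasoning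
  exponent-≤ : m + suc m + 3 * suc m ≤ 3 * (m + suc m)
  exponent-≤ = begin
    m + suc m + 3 * suc m   ≡⟨ lhs m ⟩
    3 + 5 * m + 1           ≤⟨ +-monoʳ-≤ (3 + 5 * m) 0<m ⟩
    3 + 5 * m + m           ≡⟨ rhs m ⟩
    3 * (m + suc m)         ∎
    where
    lhs : ∀ m → m + suc m + 3 * suc m ≡ 3 + 5 * m + 1
    lhs = solve-∀
    rhs : ∀ m → 3 + 5 * m + m ≡ 3 * (m + suc m)
    rhs = solve-∀

product≤8^ : ∀ X {ps} → Linked _>_ ps → All PrimeOrOne ps → All (_≤ X) ps → product ps ≤ 8 ^ X
product≤8^ = <-rec Bound step
  where
  Bound : ℕ → Set
  Bound X = ∀ {ps} → Linked _>_ ps → All PrimeOrOne ps → All (_≤ X) ps → product ps ≤ 8 ^ X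

  step : ∀ X → (∀ {Y} → Y < X → Bound Y) → Bound X
  step 0 _ l _ ≤X = product≤! 0 l ≤X
  step 1 _ l _ ≤X = ≤-trans (product≤! 1 l ≤X) (s≤s z≤n)
  step 2 _ l _ ≤X = ≤-trans (product≤! 2 l ≤X) (s≤s (s≤s z≤n))
  step X@(suc X′@(suc (suc _))) rec {ps} l po ≤X with X divMod 2
  ... | result m Fin.zero X≡m*2 = ≤-trans (rec ≤-refl l po (All.zipWith ≤∧≢⇒<′ (≤X , All.map ≢X po))) (^-monoʳ-≤ 8 (n≤1+n X′))
    where
    ≤∧≢⇒<′ : ∀ {e} → e ≤ X × e ≢ X → e ≤ X′
    ≤∧≢⇒<′ (e≤X , e≢X) = ≤-pred (≤∧≢⇒< e≤X e≢X)
    ≢X : ∀ {e} → PrimeOrOne e → e ≢ X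
    ≢X (inj₁ refl) ()
    ≢X (inj₂ pe) refl with prime⇒irreducible pe (divides m X≡m*2)
    ... | inj₁ ()
    ... | inj₂ ()
  ... | result zero    (Fin.suc Fin.zero) ()
  ... | result (suc m) (Fin.suc Fin.zero) X≡1+m*2 = begin
    product ps                                      ≡⟨ product-filter (suc M <?_) ps ⟩
    product (filter (suc M <?_) ps) * product small ≤⟨ *-mono-≤ (product[>1+m]≤2^[m+1+m] M l po (subst (λ x → All (_≤ x) ps) X≡M+1+M ≤X))
                                                                (rec 1+M<X small-descending (Allₚ.filter⁺ _ po) small≤1+M) ⟩
    2 ^ (M + suc M) * 8 ^ suc M                     ≤⟨ 2^[m+1+m]*8^[1+m]≤8^[m+1+m] M (s≤s z≤n) ⟩
    8 ^ (M + suc M)                                 ≡⟨ cong (8 ^_) X≡M+1+M ⟨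
    8 ^ X                                           ∎
    where
    open ≤-Reasoning
    M = suc m
    X≡M+1+M : X ≡ M + suc M
    X≡M+1+M = trans X≡1+m*2 (trans (cong suc (trans (*-comm M 2) (cong (M +_) (+-identityʳ M)))) (sym (+-suc M M)))
    1+M<X : suc M < X
    1+M<X = subst (suc M <_) (sym X≡M+1+M) (s≤s (m≤n+m (suc M) m))
    small = filter (¬? ∘ (suc M <?_)) ps
    small-descending : Linked _>_ small
    small-descending = Linkedₚ.filter⁺ _ >-trans l
    small≤1+M : All (_≤ suc M) small
    small≤1+M = All.map ≮⇒≥ (Allₚ.all-filter (¬? ∘ (suc M <?_)) ps)

-- All but the s smallest entries exceed s = 2^⌊ℓ/2⌋ ≤ √Y, so (1 + s)^(k ∸ s) ≤ ∏ ps ≤ 8^Y bounds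
-- r · (k ∸ s), while the s small entries only contribute r · s ≤ Y.
chebyshev-upper : ∀ Y {ps} → Linked _>_ ps → All PrimeOrOne ps → All (_≤ Y) ps → length ps * ⌊log₂ Y ⌋ ≤ 9 * Y
chebyshev-upper Y {[]}         _ _  _             = z≤n
chebyshev-upper Y {ps@(_ ∷ _)} l po ≤Y@(h≤Y ∷ _) = begin
  k * ℓ                   ≤⟨ *-monoʳ-≤ k ℓ≤1+r+r ⟩
  k * suc (r + r)         ≡⟨ expand k r ⟩
  k + (r * k + r * k)     ≤⟨ +-mono-≤ k≤Y (+-mono-≤ rk≤4Y rk≤4Y) ⟩
  Y + (4 * Y + 4 * Y)     ≡⟨ collect Y ⟩
  9 * Y                   ∎
  where
  open ≤-Reasoning
  k = length ps
  ℓ = ⌊log₂ Y ⌋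
  r = ⌊ ℓ /2⌋
  s = 2 ^ r
  0<ps = All.map primeOrOne⇒0< po
  k≤Y : k ≤ Y
  k≤Y = length≤ l 0<ps ≤Y
  ℓ≤1+r+r : ℓ ≤ suc (r + r)
  ℓ≤1+r+r = begin
    ℓ             ≡⟨ ⌊n/2⌋+⌈n/2⌉≡n ℓ ⟨
    r + ⌈ ℓ /2⌉   ≤⟨ +-monoʳ-≤ r (⌈n/2⌉≤1+⌊n/2⌋ ℓ) ⟩
    r + suc r     ≡⟨ +-suc r r ⟩
    suc (r + r)   ∎
  r[k∸s]≤3Y : r * (k ∸ s) ≤ 3 * Y
  r[k∸s]≤3Y = 2^m≤2^n⇒m≤n (begin
    2 ^ (r * (k ∸ s))     ≡⟨ ^-*-assoc 2 r (k ∸ s) ⟨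
    s ^ (k ∸ s)           ≤⟨ ^-monoˡ-≤ (k ∸ s) (n≤1+n s) ⟩
    suc s ^ (k ∸ s)       ≤⟨ [1+s]^[length∸s]≤product s l 0<ps ⟩
    product ps            ≤⟨ product≤8^ Y l po ≤Y ⟩
    8 ^ Y                 ≡⟨ ^-*-assoc 2 3 Y ⟩
    2 ^ (3 * Y)           ∎)
  rs≤Y : r * s ≤ Y
  rs≤Y = begin
    r * s                 ≤⟨ *-monoˡ-≤ s (≤-trans (m≤m+n r r) (n+n≤2^n r)) ⟩
    s * s                 ≡⟨ ^-distribˡ-+-* 2 r r ⟨
    2 ^ (r + r)           ≤⟨ ^-monoʳ-≤ 2 (≤-trans (+-monoʳ-≤ r (⌊n/2⌋≤⌈n/2⌉ ℓ)) (≤-reflexive (⌊n/2⌋+⌈n/2⌉≡n ℓ))) ⟩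
    2 ^ ℓ                 ≤⟨ proj₁ (⌊log₂⌋-bounds Y (≤-trans (All.head 0<ps) h≤Y)) ⟩
    Y                     ∎
  rk≤4Y : r * k ≤ 4 * Y
  rk≤4Y = begin
    r * k                 ≤⟨ *-monoʳ-≤ r (m≤n+m∸n k s) ⟩
    r * (s + (k ∸ s))     ≡⟨ *-distribˡ-+ r s (k ∸ s) ⟩
    r * s + r * (k ∸ s)   ≤⟨ +-mono-≤ rs≤Y r[k∸s]≤3Y ⟩
    Y + 3 * Y             ∎
  expand : ∀ k r → k * suc (r + r) ≡ k + (r * k + r * k)
  expand = solve-∀
  collect : ∀ Y → Y + (4 * Y + 4 * Y) ≡ 9 * Y
  collect = solve-∀

-- Chebyshev's lower bound

primesIn : ℕ → ℕ → List ℕ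
primesIn y zero    = []
primesIn y (suc x) with y <? suc x | prime? (suc x)
... | no _  | _     = []
... | yes _ | yes _ = suc x ∷ primesIn y x
... | yes _ | no _  = primesIn y x

π : ℕ → ℕ
π x = length (primesIn 0 x)

primesIn-bounds : ∀ y x → All (λ p → Prime p × y < p × p ≤ x) (primesIn y x)
primesIn-bounds y zero    = []
primesIn-bounds y (suc x) with y <? suc x | prime? (suc x)
... | no _      | _     = []
... | yes y<1+x | yes p = (p , y<1+x , ≤-refl) ∷ All.map (λ (pp , y<p , p≤x) → pp , y<p , m≤n⇒m≤1+n p≤x) (primesIn-bounds y x)
... | yes _     | no _  = All.map (λ (pp , y<p , p≤x) → pp , y<p , m≤n⇒m≤1+n p≤x) (primesIn-bounds y x)

primesIn-descending : ∀ y x → Linked _>_ (primesIn y x)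
primesIn-descending y zero    = []
primesIn-descending y (suc x) with y <? suc x | prime? (suc x)
... | no _  | _     = []
... | yes _ | no _  = primesIn-descending y x
... | yes _ | yes _ = ∷-descending (All.map (λ (_ , _ , p≤x) → s≤s p≤x) (primesIn-bounds y x)) (primesIn-descending y x)
  where
  ∷-descending : ∀ {z xs} → All (_< z) xs → Linked _>_ xs → Linked _>_ (z ∷ xs)
  ∷-descending []        []  = [-]
  ∷-descending (x<z ∷ _) l   = x<z ∷ l

p∈primesIn : ∀ {p y} x → Prime p → y < p → p ≤ x → p ∈ primesIn y x
p∈primesIn zero    pp y<p p≤0 = contradiction (<-≤-trans (≤-<-trans z≤n y<p) p≤0) λ ()
p∈primesIn {p} {y} (suc x) pp y<p p≤1+x with y <? suc x | prime? (suc x) | m≤n⇒m<n∨m≡n p≤1+x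
... | no y≮1+x | _      | _         = contradiction (<-≤-trans y<p p≤1+x) y≮1+x
... | yes _    | yes _  | inj₂ refl = here refl
... | yes _    | yes _  | inj₁ p≤x  = there (p∈primesIn x pp y<p (≤-pred p≤x))
... | yes _    | no ¬pr | inj₂ refl = contradiction pp ¬pr
... | yes _    | no _   | inj₁ p≤x  = p∈primesIn x pp y<p (≤-pred p≤x)

primesIn-empty : ∀ {y} x → x ≤ y → primesIn y x ≡ []
primesIn-empty         zero    _   = refl
primesIn-empty {y} (suc x) 1+x≤y with y <? suc x | prime? (suc x)
... | no _      | _ = refl
... | yes y<1+x | _ = contradiction 1+x≤y (<⇒≱ y<1+x)

primesIn-++ : ∀ {z y} x → z ≤ y → y ≤ x → primesIn y x ++ primesIn z y ≡ primesIn z x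
primesIn-++ {z} {y} x z≤y y≤x with m≤n⇒m<n∨m≡n y≤x
... | inj₂ refl = cong (_++ primesIn z y) (primesIn-empty y ≤-refl)
primesIn-++ {z} {y} (suc x) z≤y y≤x | inj₁ y<1+x with y <? suc x | z <? suc x | prime? (suc x)
... | no y≮1+x | _        | _     = contradiction y<1+x y≮1+x
... | yes _    | no z≮1+x | _     = contradiction (≤-<-trans z≤y y<1+x) z≮1+x
... | yes _    | yes _    | yes _ = cong (suc x ∷_) (primesIn-++ x z≤y (≤-pred y<1+x))
... | yes _    | yes _    | no _  = primesIn-++ x z≤y (≤-pred y<1+x)

π≡length[primesIn]+π : ∀ {y x} → y ≤ x → π x ≡ length (primesIn y x) + π y
π≡length[primesIn]+π {y} {x} y≤x = trans (cong length (sym (primesIn-++ x z≤n y≤x))) (length-++ (primesIn y x))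

π-mono-≤ : ∀ {y x} → y ≤ x → π y ≤ π x
π-mono-≤ {y} y≤x = ≤-trans (m≤n+m (π y) _) (≤-reflexive (sym (π≡length[primesIn]+π y≤x)))

largestExponentUpTo : ℕ → ℕ → ℕ → ℕ
largestExponentUpTo zero    p N = 0
largestExponentUpTo (suc k) p N with p ^ suc k ≤? N
... | yes _ = suc k
... | no _  = largestExponentUpTo k p N

p^largestExponentUpTo≤N : ∀ k p {N} → 0 < N → p ^ largestExponentUpTo k p N ≤ N
p^largestExponentUpTo≤N zero    p     0<N = 0<N
p^largestExponentUpTo≤N (suc k) p {N} 0<N with p ^ suc k ≤? N
... | yes p^[1+k]≤N = p^[1+k]≤N
... | no _          = p^largestExponentUpTo≤N k p 0<N

largestExponentUpTo-maximal : ∀ k {p N e} → e ≤ k → p ^ e ≤ N → e ≤ largestExponentUpTo k p N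
largestExponentUpTo-maximal zero    e≤0 _ = e≤0
largestExponentUpTo-maximal (suc k) {p} {N} {e} e≤1+k p^e≤N with p ^ suc k ≤? N
... | yes _         = e≤1+k
... | no p^[1+k]≰N  = largestExponentUpTo-maximal k (≤-pred (≤∧≢⇒< e≤1+k λ { refl → p^[1+k]≰N p^e≤N })) p^e≤N

-- lcmUpTo N = ∏_{p ≤ N} p ^ ⌊log_p N⌋, which is lcm(1, …, N).
lcmUpTo : ℕ → ℕ
lcmUpTo N = product (map (λ p → p ^ largestExponentUpTo N p N) (primesIn 0 N))

lcmUpTo-nonZero : ∀ N → NonZero (lcmUpTo N)
lcmUpTo-nonZero N = product≢0 (Allₚ.map⁺ (All.map (λ {p} (pp , _) → m^n≢0 p (largestExponentUpTo N p N) {{prime⇒nonZero pp}}) (primesIn-bounds 0 N)))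

lcmUpTo≤N^π : ∀ N → 0 < N → lcmUpTo N ≤ N ^ π N
lcmUpTo≤N^π N 0<N = product-map≤ (primesIn 0 N)
  where
  product-map≤ : ∀ ps → product (map (λ p → p ^ largestExponentUpTo N p N) ps) ≤ N ^ length ps
  product-map≤ []       = ≤-refl
  product-map≤ (p ∷ ps) = *-mono-≤ (p^largestExponentUpTo≤N N p 0<N) (product-map≤ ps)

p^k∣lcmUpTo : ∀ {p k N} → Prime p → p ^ k ≤ N → p ^ k ∣ lcmUpTo N
p^k∣lcmUpTo {p} {zero}  {N} _  _      = 1∣ lcmUpTo N
p^k∣lcmUpTo {p} {suc k} {N} pp p^k≤N  = ∣-trans p^k∣p^e (∈⇒∣product (∈-map⁺ (λ q → q ^ largestExponentUpTo N q N) p∈primes))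
  where
  instance _ = prime⇒nonZero pp
  p∈primes : p ∈ primesIn 0 N
  p∈primes = p∈primesIn N pp (≤-trans (s≤s z≤n) (prime⇒2≤ pp)) (≤-trans (m≤m*n p (p ^ k) {{m^n≢0 p k}}) p^k≤N)
  1+k≤N : suc k ≤ N
  1+k≤N = ≤-trans (m≤m+n (suc k) (suc k)) (≤-trans (n+n≤2^n (suc k)) (≤-trans (^-monoˡ-≤ (suc k) (prime⇒2≤ pp)) p^k≤N))
  p^k∣p^e : p ^ suc k ∣ p ^ largestExponentUpTo N p N
  p^k∣p^e = m≤n⇒p^m∣p^n p (largestExponentUpTo-maximal N 1+k≤N p^k≤N)

i∣lcmUpTo : ∀ {N} i → 0 < i → i ≤ N → i ∣ lcmUpTo N
i∣lcmUpTo {N} = <-rec _ divides-lcm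
  where
  divides-lcm : ∀ i → (∀ {j} → j < i → 0 < j → j ≤ N → j ∣ lcmUpTo N) → 0 < i → i ≤ N → i ∣ lcmUpTo N
  divides-lcm 1 _ _ _ = 1∣ lcmUpTo N
  divides-lcm i@(suc (suc _)) rec 0<i i≤N with prime-divisor i (s≤s (s≤s z≤n))
  ... | p , pp , p∣i with prime-power-decomposition pp i 0<i
  ...   | k , r , i≡p^k*r , p∤r =
    subst (_∣ lcmUpTo N) (sym i≡p^k*r) (p∤m⇒p^k*m∣n k pp p∤r (p^k∣lcmUpTo {k = k} pp (≤-trans (∣⇒≤ p^k∣i) i≤N)) r∣lcm)
    where
    r∣i : r ∣ i
    r∣i = divides (p ^ k) i≡p^k*r
    p^k∣i : p ^ k ∣ i
    p^k∣i = divides r (trans i≡p^k*r (*-comm (p ^ k) r))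
    r<i : r < i
    r<i = ≤∧≢⇒< (∣⇒≤ r∣i) λ { refl → p∤r p∣i }
    0<r : 0 < r
    0<r = n≢0⇒n>0 λ { refl → <⇒≢ 0<i (sym (trans i≡p^k*r (*-zeroʳ (p ^ k)))) }
    r∣lcm : r ∣ lcmUpTo N
    r∣lcm = rec r<i 0<r (≤-trans (<⇒≤ r<i) i≤N)

chebyshev-lower : ∀ m → m ≤ suc ⌊log₂ (m + suc m) ⌋ * π (m + suc m)
chebyshev-lower m = 2^m≤2^n⇒m≤n (begin
  2 ^ m                               ≤⟨ 2^m≤binomial[m,m] m ⟩
  binomial m m                        ≤⟨ binomial-monoˡ m m ⟩
  binomial (suc m) m                  ≤⟨ m≤n*m _ (suc m) ⟩
  suc m * binomial (suc m) m          ≤⟨ ∣⇒≤ {{lcmUpTo-nonZero N}} (consecutive∣⇒m*binomial∣ m (suc m) 1+m+k∣lcm) ⟩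
  lcmUpTo N                           ≤⟨ lcmUpTo≤N^π N 0<N ⟩
  N ^ π N                             ≤⟨ ^-monoˡ-≤ (π N) (<⇒≤ (n<2^[1+⌊log₂n⌋] N)) ⟩
  (2 ^ suc ⌊log₂ N ⌋) ^ π N           ≡⟨ ^-*-assoc 2 (suc ⌊log₂ N ⌋) (π N) ⟩
  2 ^ (suc ⌊log₂ N ⌋ * π N)           ∎)
  where
  open ≤-Reasoning
  N = m + suc m
  0<N : 0 < N
  0<N = subst (0 <_) (sym (+-suc m m)) (s≤s z≤n)
  1+m+k∣lcm : ∀ k → k ≤ m → suc m + k ∣ lcmUpTo N
  1+m+k∣lcm k k≤m = i∣lcmUpTo (suc m + k) (s≤s z≤n) (subst (suc m + k ≤_) (sym (+-suc m m)) (s≤s (+-monoʳ-≤ m k≤m)))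

-- Weighting each prime by h = log₂ x: h · π(x) ≥ m = 2^(g+6) − 1 by Chebyshev's lower bound, while
-- t · h + π(y) · h < 2^(g+6) by the hypothesis and Chebyshev's upper bound at y.
primes-in-window : ∀ {t g} → 7 ≤ g → t * (g + 7) < 2 ^ g → t ≤ length (primesIn (2 ^ g) (2 ^ (g + 7)))
primes-in-window {t} {g} 7≤g th<y = *-cancelʳ-≤ t W h (+-cancelʳ-≤ (π y * h) (t * h) (W * h) (begin
  t * h + π y * h         ≤⟨ ≤-pred (subst (t * h + π y * h <_) M≡1+m th+π[y]h<M) ⟩
  m                       ≤⟨ chebyshev-lower m ⟩
  suc ⌊log₂ N ⌋ * π N     ≤⟨ *-mono-≤ (n<2^k⇒⌊log₂n⌋<k {k = h} 0<N N<x) (π-mono-≤ (<⇒≤ N<x)) ⟩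
  h * π x                 ≡⟨ cong (h *_) (π≡length[primesIn]+π y≤x) ⟩
  h * (W + π y)           ≡⟨ trans (*-comm h (W + π y)) (*-distribʳ-+ h W (π y)) ⟩
  W * h + π y * h         ∎))
  where
  open ≤-Reasoning
  h = g + 7
  x = 2 ^ h
  y = 2 ^ g
  M = 2 ^ (g + 6)
  m = M ∸ 1
  N = m + suc m
  W = length (primesIn y x)
  instance _ = >-nonZero (≤-trans (s≤s z≤n) (m≤n+m 7 g))
  M≡1+m : M ≡ suc m
  M≡1+m = sym (m+[n∸m]≡n (m^n>0 2 (g + 6)))
  x≡M+M : x ≡ M + M
  x≡M+M = trans (cong (2 ^_) (+-suc g 6)) (cong (M +_) (+-identityʳ M))
  N<x : N < x
  N<x = subst₂ _<_ (cong (m +_) M≡1+m) (sym x≡M+M) (+-monoˡ-< M (subst (m <_) (sym M≡1+m) (n<1+n m)))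
  0<N : 0 < N
  0<N = subst (0 <_) (sym (+-suc m m)) (s≤s z≤n)
  y≤x : y ≤ x
  y≤x = ^-monoʳ-≤ 2 (m≤m+n g 7)
  π[y]g≤9y : π y * g ≤ 9 * y
  π[y]g≤9y = subst (λ ℓ → π y * ℓ ≤ 9 * y) (⌊log₂[2^n]⌋≡n g)
    (chebyshev-upper y (primesIn-descending 0 y) (All.map (λ (pp , _) → inj₂ pp) (primesIn-bounds 0 y))
                       (All.map (λ (_ , _ , p≤y) → p≤y) (primesIn-bounds 0 y)))
  th+π[y]h<M : t * h + π y * h < M
  th+π[y]h<M = begin-strict
    t * h + π y * h         ≤⟨ +-monoʳ-≤ (t * h) (*-monoʳ-≤ (π y) (+-monoʳ-≤ g 7≤g)) ⟩
    t * h + π y * (g + g)   ≡⟨ cong (t * h +_) (*-distribˡ-+ (π y) g g) ⟩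
    t * h + (π y * g + π y * g) <⟨ +-mono-<-≤ th<y (+-mono-≤ π[y]g≤9y π[y]g≤9y) ⟩
    y + (9 * y + 9 * y)     ≤⟨ ≤-reflexive (collect y) ⟩
    19 * y                  ≤⟨ *-monoˡ-≤ y (m≤m+n 19 45) ⟩
    64 * y                  ≡⟨ trans (*-comm 64 y) (sym (^-distribˡ-+-* 2 g 6)) ⟩
    M                       ∎
    where
    collect : ∀ y → y + (9 * y + 9 * y) ≡ 19 * y
    collect = solve-∀

-- The upper bound on g(n)

cofactor : ℕ → ℕ
cofactor a = quotient (P∣n a)

a≡cofactor*P : ∀ a → a ≡ cofactor a * P a
a≡cofactor*P a = m∣n⇒n≡quotient*m (P∣n a)

0<cofactor : ∀ {a} → 0 < a → 0 < cofactor a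
0<cofactor {a} 0<a = n≢0⇒n>0 λ cofactor≡0 → <⇒≢ 0<a (sym (trans (a≡cofactor*P a) (cong (_* P a) cofactor≡0)))

cofactor-< : ∀ {a b} → a < b → P b < P a → cofactor a < cofactor b
cofactor-< {a} {b} a<b Pb<Pa = *-cancelʳ-< (P b) (cofactor a) (cofactor b) (begin-strict
  cofactor a * P b   ≤⟨ *-monoʳ-≤ (cofactor a) (<⇒≤ Pb<Pa) ⟩
  cofactor a * P a   ≡⟨ a≡cofactor*P a ⟨
  a                  <⟨ a<b ⟩
  b                  ≡⟨ a≡cofactor*P b ⟩
  cofactor b * P b   ∎)
  where open ≤-Reasoning

cofactors-increasing : ∀ {n xs} → Admissible n xs → Linked _<_ (0 ∷ map cofactor xs)
cofactors-increasing {xs = []}    _                        = [-]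
cofactors-increasing {xs = _ ∷ _} ((0<a , _) ∷ _ , linked) =
  0<cofactor 0<a ∷ Linkedₚ.map⁺ (Linked.map (λ (a<b , Pb<Pa) → cofactor-< a<b Pb<Pa) linked)

admissible-split : ∀ {n} pre b post → Admissible n (pre ++ b ∷ post) →
                   suc (length pre) * P b ≤ n × length (b ∷ post) * ⌊log₂ (P b) ⌋ ≤ 9 * P b × length (b ∷ post) ≤ P b
admissible-split {n} pre b post adm@(bounds , linked) =
  index*P≤n , subst (λ k → k * ⌊log₂ (P b) ⌋ ≤ 9 * P b) (length-map P (b ∷ post)) (chebyshev-upper (P b) descending primeOrOne ≤P[b]) ,
  subst (_≤ P b) (length-map P (b ∷ post)) (length≤ descending (All.map primeOrOne⇒0< primeOrOne) ≤P[b])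
  where
  descending : Linked _>_ (map P (b ∷ post))
  descending = Linkedₚ.map⁺ (Linked.map proj₂ (Linked-++⁻ʳ pre linked))
  primeOrOne : All PrimeOrOne (map P (b ∷ post))
  primeOrOne = Allₚ.map⁺ (All.universal P-primeOrOne (b ∷ post))
  ≤P[b] : All (_≤ P b) (map P (b ∷ post))
  ≤P[b] = ≤-refl ∷ All.map <⇒≤ (Linked-∷⇒All >-trans descending)
  index<cofactor : length pre < cofactor b
  index<cofactor = subst (_< cofactor b) (length-map cofactor pre)
    (increasing-gap (map cofactor pre) (subst (λ ys → Linked _<_ (0 ∷ ys)) (map-++ cofactor pre (b ∷ post)) (cofactors-increasing adm)))
  index*P≤n : suc (length pre) * P b ≤ n
  index*P≤n = begin
    suc (length pre) * P b    ≤⟨ *-monoˡ-≤ (P b) index<cofactor ⟩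
    cofactor b * P b          ≡⟨ a≡cofactor*P b ⟨
    b                         ≤⟨ proj₂ (All.head (Allₚ.++⁻ʳ pre bounds)) ⟩
    n                         ∎
    where open ≤-Reasoning

-- Either log n ≤ 4 log Y + 8, or t ≤ 2Y is so small that t² · log n ≤ n.
upper-bound-arith : ∀ {n t J k Y} → t ≤ 2 * J → t ≤ 2 * k → J * Y ≤ n → k * ⌊log₂ Y ⌋ ≤ 9 * Y → k ≤ Y →
                    t * t * ⌊log₂ n ⌋ ≤ 176 * n
upper-bound-arith {n} {t} {J} {k} {Y} t≤2J t≤2k JY≤n kℓ≤9Y k≤Y = bound
  where
  open ≤-Reasoning
  ℓY = ⌊log₂ Y ⌋
  tt≤4Jk : t * t ≤ 4 * (J * k)
  tt≤4Jk = ≤-trans (*-mono-≤ t≤2J t≤2k) (≤-reflexive (regroup J k))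
    where
    regroup : ∀ J k → 2 * J * (2 * k) ≡ 4 * (J * k)
    regroup = solve-∀
  tt≤4n : t * t ≤ 4 * n
  tt≤4n = ≤-trans tt≤4Jk (*-monoʳ-≤ 4 (≤-trans (*-monoʳ-≤ J k≤Y) JY≤n))
  ttℓY≤36n : t * t * ℓY ≤ 36 * n
  ttℓY≤36n = begin
    t * t * ℓY              ≤⟨ *-monoˡ-≤ ℓY tt≤4Jk ⟩
    4 * (J * k) * ℓY        ≡⟨ regroup J k ℓY ⟩
    4 * (J * (k * ℓY))      ≤⟨ *-monoʳ-≤ 4 (*-monoʳ-≤ J kℓ≤9Y) ⟩
    4 * (J * (9 * Y))       ≡⟨ regroup′ J Y ⟩
    36 * (J * Y)            ≤⟨ *-monoʳ-≤ 36 JY≤n ⟩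
    36 * n                  ∎
    where
    regroup : ∀ J k l → 4 * (J * k) * l ≡ 4 * (J * (k * l))
    regroup = solve-∀
    regroup′ : ∀ J Y → 4 * (J * (9 * Y)) ≡ 36 * (J * Y)
    regroup′ = solve-∀
  bound : t * t * ⌊log₂ n ⌋ ≤ 176 * n
  bound with ⌊log₂ n ⌋ ≤? 4 * ℓY + 8
  ... | yes ℓ≤4ℓY+8 = begin
    t * t * ⌊log₂ n ⌋                 ≤⟨ *-monoʳ-≤ (t * t) ℓ≤4ℓY+8 ⟩
    t * t * (4 * ℓY + 8)              ≡⟨ distribute (t * t) ℓY ⟩
    4 * (t * t * ℓY) + 8 * (t * t)    ≤⟨ +-mono-≤ (*-monoʳ-≤ 4 ttℓY≤36n) (*-monoʳ-≤ 8 tt≤4n) ⟩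
    4 * (36 * n) + 8 * (4 * n)        ≡⟨ collect n ⟩
    176 * n                           ∎
    where
    distribute : ∀ T l → T * (4 * l + 8) ≡ 4 * (T * l) + 8 * T
    distribute = solve-∀
    collect : ∀ n → 4 * (36 * n) + 8 * (4 * n) ≡ 176 * n
    collect = solve-∀
  ... | no ℓ≰4ℓY+8 = begin
    t * t * ⌊log₂ n ⌋                 ≤⟨ *-monoˡ-≤ ⌊log₂ n ⌋ (*-mono-≤ t≤2^a t≤2^a) ⟩
    2 ^ a * 2 ^ a * ⌊log₂ n ⌋         ≤⟨ 2^a*2^a*⌊log₂n⌋≤n a n (subst (_≤ ⌊log₂ n ⌋) (four ℓY) (<⇒≤ (≰⇒> ℓ≰4ℓY+8))) ⟩
    n                                 ≤⟨ m≤n*m n 176 ⟩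
    176 * n                           ∎
    where
    a = suc (suc ℓY)
    t≤2^a : t ≤ 2 ^ a
    t≤2^a = ≤-trans t≤2k (*-monoʳ-≤ 2 (≤-trans k≤Y (<⇒≤ (n<2^[1+⌊log₂n⌋] Y))))
    four : ∀ l → 4 * l + 8 ≡ 4 * suc (suc l)
    four = solve-∀

upper-bound : ∀ {n t} → Attainable n t → t * t * ⌊log₂ n ⌋ ≤ 176 * n
upper-bound {t = zero}          _                   = z≤n
upper-bound {n} {t@(suc t-1)} (xs , adm , ∣xs∣≡t) with split-at ⌊ t /2⌋ xs (subst (⌊ t /2⌋ <_) (sym ∣xs∣≡t) (⌊n/2⌋<n t-1))
... | pre , b , post , refl , j≡⌊t/2⌋ with admissible-split pre b post adm
...   | J*Y≤n , kλ≤9Y , k≤Y = upper-bound-arith t≤2J t≤2k J*Y≤n kλ≤9Y k≤Y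
  where
  j = length pre
  k = length (b ∷ post)
  t≡j+k : t ≡ j + k
  t≡j+k = trans (sym ∣xs∣≡t) (length-++ pre)
  k≡⌈t/2⌉ : k ≡ ⌈ t /2⌉
  k≡⌈t/2⌉ = +-cancelˡ-≡ ⌊ t /2⌋ k ⌈ t /2⌉ (trans (cong (_+ k) (sym j≡⌊t/2⌋)) (trans (sym t≡j+k) (sym (⌊n/2⌋+⌈n/2⌉≡n t))))
  t≤2J : t ≤ 2 * suc j
  t≤2J = begin
    t                  ≡⟨ t≡j+k ⟩
    j + k              ≤⟨ +-monoʳ-≤ j (subst₂ _≤_ (sym k≡⌈t/2⌉) (cong suc (sym j≡⌊t/2⌋)) (⌈n/2⌉≤1+⌊n/2⌋ t)) ⟩
    j + suc j          ≤⟨ +-monoˡ-≤ (suc j) (n≤1+n j) ⟩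
    suc j + suc j      ≡⟨ cong (suc j +_) (+-identityʳ (suc j)) ⟨
    2 * suc j          ∎
    where open ≤-Reasoning
  t≤2k : t ≤ 2 * k
  t≤2k = begin
    t                  ≡⟨ t≡j+k ⟩
    j + k              ≤⟨ +-monoˡ-≤ k (subst₂ _≤_ (sym j≡⌊t/2⌋) (sym k≡⌈t/2⌉) (⌊n/2⌋≤⌈n/2⌉ t)) ⟩
    k + k              ≡⟨ cong (k +_) (+-identityʳ k) ⟨
    2 * k              ∎
    where open ≤-Reasoning

-- The lower bound on g(n)

nextMultiple : ℕ → ℕ → ℕ
nextMultiple zero    a = 0
nextMultiple (suc q) a = suc q * suc (a / suc q)

a<nextMultiple : ∀ {q} a → 0 < q → a < nextMultiple q a
a<nextMultiple {suc q} a _ = begin-strict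
  a                             ≡⟨ m≡m%n+[m/n]*n a (suc q) ⟩
  a % suc q + a / suc q * suc q <⟨ +-monoˡ-< (a / suc q * suc q) (m%n<n a (suc q)) ⟩
  suc q + a / suc q * suc q     ≡⟨ trans (cong (suc q +_) (*-comm (a / suc q) (suc q))) (sym (*-suc (suc q) (a / suc q))) ⟩
  suc q * suc (a / suc q)       ∎
  where open ≤-Reasoning

nextMultiple≤a+q : ∀ q a → nextMultiple q a ≤ a + q
nextMultiple≤a+q zero    a = z≤n
nextMultiple≤a+q (suc q) a = begin
  suc q * suc (a / suc q)       ≡⟨ trans (*-suc (suc q) (a / suc q)) (cong (suc q +_) (*-comm (suc q) (a / suc q))) ⟩
  suc q + a / suc q * suc q     ≤⟨ +-monoʳ-≤ (suc q) (m/n*n≤m a (suc q)) ⟩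
  suc q + a                     ≡⟨ +-comm (suc q) a ⟩
  a + suc q                     ∎
  where open ≤-Reasoning

P[nextMultiple]≡q : ∀ {q y} a → Prime q → y < q → nextMultiple q a ≤ y * y → P (nextMultiple q a) ≡ q
P[nextMultiple]≡q {suc q} {y} a pq y<q ≤y*y = P[q*m]≡q pq (s≤s z≤n) (<⇒≤ 1+a/q<q)
  where
  1+a/q<q : suc (a / suc q) < suc q
  1+a/q<q = *-cancelˡ-< (suc q) _ _ (≤-<-trans ≤y*y (*-mono-< y<q y<q))

multiplesChain : ℕ → List ℕ → List ℕ
multiplesChain a []       = []
multiplesChain a (q ∷ qs) = nextMultiple q a ∷ multiplesChain (nextMultiple q a) qs

length-multiplesChain : ∀ a qs → length (multiplesChain a qs) ≡ length qs
length-multiplesChain a []       = refl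
length-multiplesChain a (q ∷ qs) = cong suc (length-multiplesChain _ qs)

multiplesChain-increasing : ∀ a {qs} → All (0 <_) qs → Linked _<_ (a ∷ multiplesChain a qs)
multiplesChain-increasing a []         = [-]
multiplesChain-increasing a (0<q ∷ 0<qs) = a<nextMultiple a 0<q ∷ multiplesChain-increasing _ 0<qs

multiplesChain-bounded : ∀ {x} a {qs} → All (_≤ x) qs → All (_≤ a + length qs * x) (multiplesChain a qs)
multiplesChain-bounded             a []             = []
multiplesChain-bounded {x} a {q ∷ qs} (q≤x ∷ qs≤x) =
  ≤-trans b≤a+x (+-monoʳ-≤ a (m≤m+n x _)) ∷ All.map (λ c≤ → ≤-trans c≤ (≤-trans (+-monoˡ-≤ _ b≤a+x) (≤-reflexive (+-assoc a x _)))) (multiplesChain-bounded b qs≤x)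
  where
  b = nextMultiple q a
  b≤a+x : b ≤ a + x
  b≤a+x = ≤-trans (nextMultiple≤a+q q a) (+-monoʳ-≤ a q≤x)

P[multiplesChain] : ∀ {x y} a {qs} → All (λ q → Prime q × y < q × q ≤ x) qs → a + length qs * x ≤ y * y → map P (multiplesChain a qs) ≡ qs
P[multiplesChain] a {[]} [] _ = refl
P[multiplesChain] {x} {y} a {q ∷ qs} ((pq , y<q , q≤x) ∷ qs-ok) bound =
  cong₂ _∷_ (P[nextMultiple]≡q a pq y<q (≤-trans b≤a+x (≤-trans (+-monoʳ-≤ a (m≤m+n x _)) bound)))
            (P[multiplesChain] b qs-ok (≤-trans (+-monoˡ-≤ _ b≤a+x) (≤-trans (≤-reflexive (+-assoc a x _)) bound)))
  where
  b = nextMultiple q a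
  b≤a+x : b ≤ a + x
  b≤a+x = ≤-trans (nextMultiple≤a+q q a) (+-monoʳ-≤ a q≤x)

attainable-from-primes : ∀ {n t x y} → t ≤ length (primesIn y x) → t * x ≤ y * y → t * x ≤ n → Attainable n t
attainable-from-primes {n} {t} {x} {y} t≤π tx≤y² tx≤n = xs , (bounds , linked) , trans (length-multiplesChain 0 qs) ∣qs∣≡t
  where
  qs = take t (primesIn y x)
  xs = multiplesChain 0 qs
  ∣qs∣≡t : length qs ≡ t
  ∣qs∣≡t = trans (length-take t (primesIn y x)) (m≤n⇒m⊓n≡m t≤π)
  qs-ok : All (λ q → Prime q × y < q × q ≤ x) qs
  qs-ok = Allₚ.take⁺ t (primesIn-bounds y x)
  qs-descending : Linked _>_ qs
  qs-descending = Linkedₚ.AllPairs⇒Linked (AllPairsₚ.take⁺ t (Linkedₚ.Linked⇒AllPairs >-trans (primesIn-descending y x)))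
  increasing : Linked _<_ (0 ∷ xs)
  increasing = multiplesChain-increasing 0 (All.map (λ (pq , _) → ≤-trans (s≤s z≤n) (prime⇒2≤ pq)) qs-ok)
  ∣qs∣x≡tx : length qs * x ≡ t * x
  ∣qs∣x≡tx = cong (_* x) ∣qs∣≡t
  bounds : All (λ a → 0 < a × a ≤ n) xs
  bounds = All.zip (Linked-∷⇒All <-trans increasing , All.map (λ a≤ → ≤-trans a≤ (≤-trans (≤-reflexive ∣qs∣x≡tx) tx≤n)) (multiplesChain-bounded 0 (All.map (λ (_ , _ , q≤x) → q≤x) qs-ok)))
  linked : Linked (λ a b → a < b × P b < P a) xs
  linked = Linked.zip (Linked.tail increasing , Linkedₚ.map⁻ (subst (Linked _>_) (sym (P[multiplesChain] 0 qs-ok (≤-trans (≤-reflexive ∣qs∣x≡tx) tx≤y²))) qs-descending))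

-- With t = 2^s, y = 2^(s+k+8) and x = 2⁷ y: t · x = 2^(ℓ ∸ w) ≤ n and t · x ≤ y², while
-- t · log₂ x < t · 2^(k+1) ≤ y, and n < 2^(ℓ+1) ≤ 2^17 · t² · 2^k.
lower-bound-witness : ∀ {n} s k w → 0 < n → w ≤ 1 → ⌊log₂ n ⌋ ≡ s + s + k + 15 + w →
                      2 ^ k ≤ ⌊log₂ n ⌋ → ⌊log₂ n ⌋ < 2 ^ suc k →
                      Attainable n (2 ^ s) × n ≤ 2 ^ 17 * (2 ^ s * 2 ^ s * ⌊log₂ n ⌋)
lower-bound-witness {n} s k w 0<n w≤1 ℓ≡ 2^k≤ℓ ℓ<2^[1+k] =
  attainable-from-primes (primes-in-window 7≤g t[g+7]<y) tx≤y² tx≤n , n≤2^17*t*t*ℓ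
  where
  open ≤-Reasoning
  ℓ = ⌊log₂ n ⌋
  g = s + k + 8
  t = 2 ^ s
  x = 2 ^ (g + 7)
  y = 2 ^ g
  7≤g : 7 ≤ g
  7≤g = ≤-trans (n≤1+n 7) (m≤n+m 8 (s + k))
  tx≡ : t * x ≡ 2 ^ (s + s + k + 15)
  tx≡ = trans (sym (^-distribˡ-+-* 2 s (g + 7))) (cong (2 ^_) (e₁ s k))
    where
    e₁ : ∀ s k → s + (s + k + 8 + 7) ≡ s + s + k + 15
    e₁ = solve-∀
  tx≤n : t * x ≤ n
  tx≤n = begin
    t * x                   ≡⟨ tx≡ ⟩
    2 ^ (s + s + k + 15)    ≤⟨ ^-monoʳ-≤ 2 (≤-trans (m≤m+n (s + s + k + 15) w) (≤-reflexive (sym ℓ≡))) ⟩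
    2 ^ ℓ                   ≤⟨ proj₁ (⌊log₂⌋-bounds n 0<n) ⟩
    n                       ∎
  tx≤y² : t * x ≤ y * y
  tx≤y² = begin
    t * x                   ≡⟨ tx≡ ⟩
    2 ^ (s + s + k + 15)    ≤⟨ ^-monoʳ-≤ 2 (≤-trans (m≤m+n (s + s + k + 15) (k + 1)) (≤-reflexive (e₂ s k))) ⟩
    2 ^ (g + g)             ≡⟨ ^-distribˡ-+-* 2 g g ⟩
    y * y                   ∎
    where
    e₂ : ∀ s k → s + s + k + 15 + (k + 1) ≡ s + k + 8 + (s + k + 8)
    e₂ = solve-∀
  t[g+7]<y : t * (g + 7) < y
  t[g+7]<y = begin-strict
    t * (g + 7)             ≤⟨ *-monoʳ-≤ t (subst (g + 7 ≤_) (sym ℓ≡) (≤-trans (m≤m+n (g + 7) (s + w)) (≤-reflexive (e₃ s k w)))) ⟩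
    t * ℓ                   <⟨ *-monoʳ-< t {{m^n≢0 2 s}} ℓ<2^[1+k] ⟩
    t * 2 ^ suc k           ≡⟨ ^-distribˡ-+-* 2 s (suc k) ⟨
    2 ^ (s + suc k)         ≤⟨ ^-monoʳ-≤ 2 (≤-trans (m≤m+n (s + suc k) 7) (≤-reflexive (e₄ s k))) ⟩
    y                       ∎
    where
    e₃ : ∀ s k w → s + k + 8 + 7 + (s + w) ≡ s + s + k + 15 + w
    e₃ = solve-∀
    e₄ : ∀ s k → s + suc k + 7 ≡ s + k + 8
    e₄ = solve-∀
  n≤2^17*t*t*ℓ : n ≤ 2 ^ 17 * (t * t * ℓ)
  n≤2^17*t*t*ℓ = begin
    n                               ≤⟨ <⇒≤ (n<2^[1+⌊log₂n⌋] n) ⟩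
    2 ^ suc ℓ                       ≤⟨ ^-monoʳ-≤ 2 (subst (λ e → suc e ≤ 17 + (s + s + k)) (sym ℓ≡) (≤-trans (+-monoʳ-≤ _ w≤1) (≤-reflexive (e₅ s k)))) ⟩
    2 ^ (17 + (s + s + k))          ≡⟨ ^-distribˡ-+-* 2 17 (s + s + k) ⟩
    2 ^ 17 * 2 ^ (s + s + k)        ≡⟨ cong (2 ^ 17 *_) (trans (^-distribˡ-+-* 2 (s + s) k) (cong (_* 2 ^ k) (^-distribˡ-+-* 2 s s))) ⟩
    2 ^ 17 * (t * t * 2 ^ k)        ≤⟨ *-monoʳ-≤ (2 ^ 17) (*-monoʳ-≤ (t * t) 2^k≤ℓ) ⟩
    2 ^ 17 * (t * t * ℓ)            ∎
    where
    e₅ : ∀ s k → suc (s + s + k + 15) + 1 ≡ 17 + (s + s + k)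
    e₅ = solve-∀

lower-bound : ∀ n → 2 ^ 32 ≤ n → Σ ℕ λ t → Attainable n t × n ≤ 2 ^ 17 * (t * t * ⌊log₂ n ⌋)
lower-bound n 2^32≤n = 2 ^ s , lower-bound-witness s k w 0<n w≤1 ℓ≡ (proj₁ ℓ-bounds) (proj₂ ℓ-bounds)
  where
  open DivMod ((⌊log₂ n ⌋ ∸ (⌊log₂ ⌊log₂ n ⌋ ⌋ + 15)) divMod 2) renaming (quotient to s; remainder to r; property to d≡w+s*2)
  w = Fin.toℕ r
  w≤1 : w ≤ 1
  w≤1 = toℕ≤pred[n] r
  ℓ = ⌊log₂ n ⌋
  k = ⌊log₂ ℓ ⌋
  0<n : 0 < n
  0<n = ≤-trans (m^n>0 2 32) 2^32≤n
  32≤ℓ : 32 ≤ ℓ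
  32≤ℓ = 2^k≤n⇒k≤⌊log₂n⌋ 2^32≤n
  ℓ-bounds : 2 ^ k ≤ ℓ × ℓ < 2 ^ suc k
  ℓ-bounds = ⌊log₂⌋-bounds ℓ (≤-trans (s≤s z≤n) 32≤ℓ)
  k+15≤ℓ : k + 15 ≤ ℓ
  k+15≤ℓ = ⌊log₂n⌋+15≤n 32≤ℓ
  ℓ≡ : ℓ ≡ s + s + k + 15 + w
  ℓ≡ = begin
    ℓ                         ≡⟨ m+[n∸m]≡n k+15≤ℓ ⟨
    k + 15 + (ℓ ∸ (k + 15))   ≡⟨ cong (k + 15 +_) d≡w+s*2 ⟩
    k + 15 + (w + s * 2)      ≡⟨ rearrange s k w ⟩
    s + s + k + 15 + w        ∎
    where
    open ≡-Reasoning
    rearrange : ∀ s k w → k + 15 + (w + s * 2) ≡ s + s + k + 15 + w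
    rearrange = solve-∀

mainTheorem1 :
    Σ ℕ λ c₁ → Σ ℕ λ c₂ → Σ ℕ λ N →
      0 < c₁ × 0 < c₂ ×
      ((n : ℕ) → N ≤ n →
        (Σ ℕ λ t → Attainable n t × n ≤ c₁ * (t * t * ⌊log₂ n ⌋)) ×
        ((t : ℕ) → Attainable n t → t * t * ⌊log₂ n ⌋ ≤ c₂ * n))
mainTheorem1 = 2 ^ 17 , 176 , 2 ^ 32 , m^n>0 2 17 , s≤s z≤n , λ n 2^32≤n → lower-bound n 2^32≤n , λ _ → upper-bound
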